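{- Let $f\in\mathbb{Z}_n^{\mathbb{Z}_n}$. The functional directed graph $G_f$ is graceful if and only if \[ 0\not\equiv\mathrm{LCM}\left\{ \prod_{0\le i<j<n}(x_j-x_i),\ \prod_{0\le i<j<n}\Big((x_{f(j)}-x_j)^2-(x_{f(i)}-x_i)^2\Big)\right\}\ \bmod\ \left\{(x_k)^{\underline{n}}:k\in\mathbb{Z}_n\right\}. \]
   Context: $\mathbb{Z}_n:=\{0,\dots,n-1\}$; $\mathbb{Z}_n^{\mathbb{Z}_n}$ is the set of maps $\mathbb{Z}_n\to\mathbb{Z}_n$; $G_f$ has vertex set $\mathbb{Z}_n$ and directed edges $(i,f(i))$; $G_f$ is graceful if some $\sigma\in S_n$ satisfies $\{|\sigma f\sigma^{(-1)}(i)-i|:i\in\mathbb{Z}_n\}=\mathbb{Z}_n$. Polynomials live in $\mathbb{Q}[x_0,\dots,x_{n-1}]$; LCM is the least common multiple (product of the irreducible factors each raised to its maximal multiplicity). $x^{\underline{n}}:=\prod_{j\in\mathbb{Z}_n}(x-j)$. Reduction "mod $\{(x_k)^{\underline{n}}:k\in\mathbb{Z}_n\}$" means taking the canonical representative, namely the unique polynomial of degree $<n$ in each variable agreeing with the given polynomial at all points of $(\mathbb{Z}_n)^n$ (given by Lagrange interpolation $\sum_{g\in\mathbb{Z}_n^{\mathbb{Z}_n}}H(g(0),\dots,g(n-1))\prod_{k}\prod_{j\in\mathbb{Z}_n\setminus\{g(k)\}}\frac{x_k-j}{g(k)-j}$). -}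

module Defs where

open import Data.Nat as ℕ using (ℕ; zero; suc; _<_; ∣_-_∣; compare; less; equal; greater)
open import Data.Nat.Properties using (_<?_)
open import Data.Integer using (+_)
open import Data.Rational as ℚ using (ℚ; 0ℚ; 1ℚ; _/_)
open import Data.Fin using (Fin; toℕ)
open import Data.Fin.Properties using (_≟_)
open import Data.Fin.Permutation using (Permutation′; _⟨$⟩ʳ_; _⟨$⟩ˡ_)
open import Data.Vec as Vec using (Vec; []; _∷_; lookup; replicate; zipWith; _[_]≔_)
open import Data.Vec.Properties using (≡-dec)
open import Data.List as List using (List; []; _∷_; _++_; map; concatMap; filter; allFin; foldr)
open import Data.Product using (_×_; _,_; ∃-syntax; Σ-syntax)
open import Function.Bundles using (_⇔_)
open import Relation.Nullary using (¬_; ¬?; yes; no)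
open import Relation.Binary.PropositionalEquality using (_≡_)

-- A polynomial is a finite formal sum of terms c · x^e (c ∈ ℚ, e an
-- exponent vector); two polynomials are equal iff every monomial has
-- the same total coefficient.

Term : ℕ → Set
Term n = ℚ × Vec ℕ n

Poly : ℕ → Set
Poly n = List (Term n)

coeff : ∀ {n} → Poly n → Vec ℕ n → ℚ
coeff [] e = 0ℚ
coeff ((c , e′) ∷ p) e with ≡-dec ℕ._≟_ e′ e
... | yes _ = c ℚ.+ coeff p e
... | no  _ = coeff p e

infix 4 _≈_
_≈_ : ∀ {n} → Poly n → Poly n → Set
p ≈ q = ∀ e → coeff p e ≡ coeff q e

0P : ∀ {n} → Poly n
0P = []

const : ∀ {n} → ℚ → Poly n
const {n} c = (c , replicate n 0) ∷ []

1P : ∀ {n} → Poly n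
1P = const 1ℚ

var : ∀ {n} → Fin n → Poly n
var {n} k = (1ℚ , (replicate n 0 [ k ]≔ 1)) ∷ []

infixl 6 _+P_ _-P_
infixl 7 _*P_

_+P_ : ∀ {n} → Poly n → Poly n → Poly n
p +P q = p ++ q

-P_ : ∀ {n} → Poly n → Poly n
-P p = map (λ { (c , e) → (ℚ.- c , e) }) p

_-P_ : ∀ {n} → Poly n → Poly n → Poly n
p -P q = p +P (-P q)

_*P_ : ∀ {n} → Poly n → Poly n → Poly n
p *P q = concatMap (λ { (c , e) → map (λ { (d , e′) → (c ℚ.* d , zipWith ℕ._+_ e e′) }) q }) p

prodP : ∀ {n} → List (Poly n) → Poly n
prodP = foldr _*P_ 1P

sumP : ∀ {n} → List (Poly n) → Poly n
sumP = foldr _+P_ 0P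

powℚ : ℚ → ℕ → ℚ
powℚ x zero = 1ℚ
powℚ x (suc m) = x ℚ.* powℚ x m

evalP : ∀ {n} → Poly n → Vec ℚ n → ℚ
evalP [] x = 0ℚ
evalP ((c , e) ∷ p) x = c ℚ.* Vec.foldr′ ℚ._*_ 1ℚ (zipWith powℚ x e) ℚ.+ evalP p x

_∣P_ : ∀ {n} → Poly n → Poly n → Set
p ∣P q = ∃[ r ] (p *P r ≈ q)

IsLCM : ∀ {n} → Poly n → Poly n → Poly n → Set
IsLCM P Q L = P ∣P L × Q ∣P L × (∀ M → P ∣P M → Q ∣P M → L ∣P M)

-- Reduction mod {x_k^{falling n}} : canonical representative given by
-- Lagrange interpolation on the grid (ℤ_n)^n.

ℕtoℚ : ℕ → ℚ
ℕtoℚ m = + m / 1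

-- 1 / (a - j) for a ≢ j (the value for a ≡ j is irrelevant)
invDiff : ℕ → ℕ → ℚ
invDiff a j with compare a j
... | less    _ k = ℚ.- (+ 1 / suc k)
... | equal   _   = 1ℚ
... | greater _ k = + 1 / suc k

allVecs : ∀ {n} m → List (Vec (Fin n) m)
allVecs zero = [] ∷ []
allVecs {n} (suc m) = concatMap (λ a → map (a ∷_) (allVecs m)) (allFin n)

lagrangeFactor : ∀ {n} → Fin n → Fin n → Poly n
lagrangeFactor {n} k a =
  prodP (map (λ j → (var k -P const (ℕtoℚ (toℕ j))) *P const (invDiff (toℕ a) (toℕ j)))
             (filter (λ j → ¬? (a ≟ j)) (allFin n)))

reduce : ∀ {n} → Poly n → Poly n
reduce {n} H =
  sumP (map (λ g → const (evalP H (Vec.map (λ a → ℕtoℚ (toℕ a)) g))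
                   *P prodP (map (λ k → lagrangeFactor k (lookup g k)) (allFin n)))
            (allVecs n))

prodPairs : ∀ {n} → (Fin n → Fin n → Poly n) → Poly n
prodPairs {n} F =
  prodP (concatMap (λ j → map (λ i → F i j) (filter (λ i → toℕ i <? toℕ j) (allFin n)))
                   (allFin n))

vandermonde : ∀ n → Poly n
vandermonde n = prodPairs (λ i j → var j -P var i)

sq : ∀ {n} → Poly n → Poly n
sq p = p *P p

gracePoly : ∀ {n} → (Fin n → Fin n) → Poly n
gracePoly f = prodPairs (λ i j → sq (var (f j) -P var j) -P sq (var (f i) -P var i))

Graceful : ∀ {n} → (Fin n → Fin n) → Set
Graceful {n} f =
  Σ[ σ ∈ Permutation′ n ]
    (∀ m → (∃[ i ] ∣ toℕ (σ ⟨$⟩ʳ f (σ ⟨$⟩ˡ i)) - toℕ i ∣ ≡ m) ⇔ m < n)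

{-# OPTIONS --safe #-}
-- A grid point y ∈ ℤₙⁿ is a candidate labelling k ↦ y_k. The Vandermonde product is nonzero at y
-- iff the labels are distinct, and the second product iff the edge lengths |y_{f k} − y_k| are
-- distinct; distinct labels with n distinct lengths, all below n, are exactly a permutation σ = y
-- making σ f σ⁻¹ graceful. Since L divides the product of the two polynomials and each of them
-- divides L, L(y) ≠ 0 iff both are nonzero at y. Finally reduce L is the Lagrange interpolant of L
-- on the grid, so it is nonzero iff L is nonzero at some grid point.
module Submission where

open import Defs
open import Data.Nat using (ℕ)
open import Data.Fin using (Fin)
open import Function.Bundles using (_⇔_)
open import Relation.Nullary using (¬_)

open import Data.Empty using (⊥-elim)
open import Data.Fin using (toℕ; fromℕ<; punchOut) renaming (zero to fzero; suc to fsuc)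
import Data.Fin.Properties as FinP
open import Data.Fin.Permutation using (Permutation′; permutation; _⟨$⟩ʳ_; _⟨$⟩ˡ_; inverseˡ)
open import Data.Integer as ℤ using (+_)
import Data.Integer.Properties as ℤP
open import Data.List using (List; []; _∷_; _++_; map; foldr; concatMap; filter; length; allFin; tabulate)
import Data.List.Properties as ListP
open import Data.List.Membership.Propositional using (_∈_)
open import Data.List.Membership.Propositional.Properties
  using (∈-allFin; ∈-filter⁺; ∈-filter⁻; ∈-map⁺; ∈-map⁻; ∈-concat⁺′; ∈-concat⁻′)
open import Data.List.Relation.Unary.All as All using (All; []; _∷_; all?)
import Data.List.Relation.Unary.All.Properties as AllP
open import Data.List.Relation.Unary.All.Properties.Core using (¬All⇒Any¬)
open import Data.List.Relation.Unary.Any using (here; there; satisfied)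
open import Data.Nat as ℕ using (zero; suc; _<_; ∣_-_∣)
open import Data.Nat.Coprimality using (1-coprimeTo) renaming (sym to coprime-sym)
open import Data.Nat.Induction using (<-wellFounded)
import Data.Nat.Properties as ℕP
open import Data.Product using (_×_; _,_; proj₁; proj₂; ∃; ∃-syntax)
import Data.Product.Function.Dependent.Propositional as Σ
open import Data.Product.Function.NonDependent.Propositional using (_×-⇔_)
open import Data.Rational as ℚ using (ℚ; 0ℚ; 1ℚ; mkℚ; _/_)
import Data.Rational.Properties as ℚP
open import Algebra.Properties.Group ℚP.+-0-group using (x∙y⁻¹≈ε⇒x≈y; x≈y⇒x∙y⁻¹≈ε)
open import Data.Rational.Solver using (module +-*-Solver)
open +-*-Solver using (solve; _:+_; _:*_; :-_; _:-_; _:=_; con)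
open import Data.Sum as Sum using (_⊎_; inj₁; inj₂)
open import Data.Vec as Vec using (Vec; []; _∷_; lookup; replicate; zipWith; _[_]≔_)
open import Data.Vec.Properties as VecP using (≡-dec)
open import Data.Vec.Relation.Binary.Pointwise.Extensional using (ext; Pointwise-≡⇒≡)
open import Function using (_∘_; id)
open import Function.Bundles using (mk⇔; Equivalence)
open import Function.Construct.Symmetry using (⇔-sym)
open import Function.Definitions using (Injective)
import Function.Related.Propositional as Related
open import Induction.WellFounded using (Acc; acc)
open import Relation.Binary.Definitions using (tri<; tri≈; tri>)
open import Relation.Binary.PropositionalEquality
open import Relation.Nullary using (yes; no; ¬?)

-- Arithmetic in ℚ and the embedding ℕ → ℚ

difference≡0⇔≡ : ∀ x y → (x ℚ.- y ≡ 0ℚ) ⇔ (x ≡ y)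
difference≡0⇔≡ x y = mk⇔ (x∙y⁻¹≈ε⇒x≈y x y) x≈y⇒x∙y⁻¹≈ε

p*q≢0 : ∀ {x y} → x ≢ 0ℚ → y ≢ 0ℚ → x ℚ.* y ≢ 0ℚ
p*q≢0 {x} {y} x≢0 y≢0 xy≡0 = y≢0 (begin
  y                    ≡⟨ sym (ℚP.*-identityˡ y) ⟩
  1ℚ ℚ.* y             ≡⟨ cong (ℚ._* y) (sym (ℚP.*-inverseˡ x)) ⟩
  ℚ.1/ x ℚ.* x ℚ.* y   ≡⟨ ℚP.*-assoc (ℚ.1/ x) x y ⟩
  ℚ.1/ x ℚ.* (x ℚ.* y) ≡⟨ cong (ℚ.1/ x ℚ.*_) xy≡0 ⟩
  ℚ.1/ x ℚ.* 0ℚ        ≡⟨ ℚP.*-zeroʳ (ℚ.1/ x) ⟩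
  0ℚ                   ∎)
  where
  open ≡-Reasoning
  instance _ = ℚ.≢-nonZero x≢0

ℕtoℚ≡mkℚ : ∀ m → ℕtoℚ m ≡ mkℚ (+ m) 0 (coprime-sym (1-coprimeTo m))
ℕtoℚ≡mkℚ m = ℚP.↥p/↧p≡p _

ℕtoℚ-+ : ∀ a b → ℕtoℚ (a ℕ.+ b) ≡ ℕtoℚ a ℚ.+ ℕtoℚ b
ℕtoℚ-+ a b rewrite ℕtoℚ≡mkℚ a | ℕtoℚ≡mkℚ b =
  cong (_/ 1) (trans (ℤP.pos-+ a b)
    (sym (cong₂ ℤ._+_ (ℤP.*-identityʳ (+ a)) (ℤP.*-identityʳ (+ b)))))

ℕtoℚ-* : ∀ a b → ℕtoℚ (a ℕ.* b) ≡ ℕtoℚ a ℚ.* ℕtoℚ b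
ℕtoℚ-* a b rewrite ℕtoℚ≡mkℚ a | ℕtoℚ≡mkℚ b = cong (_/ 1) (ℤP.pos-* a b)

ℕtoℚ-injective : ∀ {a b} → ℕtoℚ a ≡ ℕtoℚ b → a ≡ b
ℕtoℚ-injective {a} {b} eq rewrite ℕtoℚ≡mkℚ a | ℕtoℚ≡mkℚ b =
  ℤP.+-injective (proj₁ (ℚP.mkℚ-injective eq))

ℕtoℚ-difference-suc : ∀ a b → ℕtoℚ (suc a) ℚ.- ℕtoℚ (suc b) ≡ ℕtoℚ a ℚ.- ℕtoℚ b
ℕtoℚ-difference-suc a b rewrite ℕtoℚ-+ 1 a | ℕtoℚ-+ 1 b =
  solve 2 (λ x y → (con 1ℚ :+ x) :- (con 1ℚ :+ y) := x :- y) refl (ℕtoℚ a) (ℕtoℚ b)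

ℕtoℚ-difference : ∀ a b → ℕtoℚ a ℚ.- ℕtoℚ b ≡ ℕtoℚ ∣ a - b ∣
                        ⊎ ℕtoℚ a ℚ.- ℕtoℚ b ≡ ℚ.- ℕtoℚ ∣ a - b ∣
ℕtoℚ-difference zero    b       = inj₂ (ℚP.+-identityˡ _)
ℕtoℚ-difference (suc a) zero    = inj₁ (ℚP.+-identityʳ _)
ℕtoℚ-difference (suc a) (suc b) =
  Sum.map (trans (ℕtoℚ-difference-suc a b)) (trans (ℕtoℚ-difference-suc a b)) (ℕtoℚ-difference a b)

ℕtoℚ-difference² : ∀ a b → (ℕtoℚ a ℚ.- ℕtoℚ b) ℚ.* (ℕtoℚ a ℚ.- ℕtoℚ b) ≡ ℕtoℚ (∣ a - b ∣ ℕ.* ∣ a - b ∣)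
ℕtoℚ-difference² a b with ℕtoℚ-difference a b
... | inj₁ eq rewrite eq = sym (ℕtoℚ-* ∣ a - b ∣ ∣ a - b ∣)
... | inj₂ eq rewrite eq = trans (solve 1 (λ d → (:- d) :* (:- d) := d :* d) refl (ℕtoℚ ∣ a - b ∣))
                                 (sym (ℕtoℚ-* ∣ a - b ∣ ∣ a - b ∣))

ℕtoℚ-difference≡0⇔≡ : ∀ a b → (ℕtoℚ a ℚ.- ℕtoℚ b ≡ 0ℚ) ⇔ (a ≡ b)
ℕtoℚ-difference≡0⇔≡ a b = mk⇔ (ℕtoℚ-injective ∘ Equivalence.to (difference≡0⇔≡ _ _))
                               (Equivalence.from (difference≡0⇔≡ _ _) ∘ cong ℕtoℚ)

square-injective : ∀ {u v} → u ℕ.* u ≡ v ℕ.* v → u ≡ v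
square-injective {u} {v} eq with ℕP.<-cmp u v
... | tri< u<v _ _ = ⊥-elim (ℕP.<-irrefl eq (ℕP.*-mono-< u<v u<v))
... | tri≈ _ u≡v _ = u≡v
... | tri> _ _ v<u = ⊥-elim (ℕP.<-irrefl (sym eq) (ℕP.*-mono-< v<u v<u))

ℕtoℚ-suc-inverse : ∀ k → ℕtoℚ (suc k) ℚ.* (+ 1 / suc k) ≡ 1ℚ
ℕtoℚ-suc-inverse k rewrite ℕtoℚ≡mkℚ (suc k) | ℚP.↥p/↧p≡p (mkℚ (+ 1) k (1-coprimeTo (suc k))) =
  ℚP.*-inverseʳ (mkℚ (+ suc k) 0 (coprime-sym (1-coprimeTo (suc k))))

ℕtoℚ-+-suc : ∀ a k → ℕtoℚ (suc (a ℕ.+ k)) ≡ ℕtoℚ a ℚ.+ ℕtoℚ (suc k)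
ℕtoℚ-+-suc a k = trans (cong ℕtoℚ (sym (ℕP.+-suc a k))) (ℕtoℚ-+ a (suc k))

invDiff-inverse : ∀ a j → a ≢ j → (ℕtoℚ a ℚ.- ℕtoℚ j) ℚ.* invDiff a j ≡ 1ℚ
invDiff-inverse a j a≢j with ℕ.compare a j
... | ℕ.less .a k = begin
  (ℕtoℚ a ℚ.- ℕtoℚ (suc (a ℕ.+ k))) ℚ.* ℚ.- (+ 1 / suc k)
    ≡⟨ cong (λ z → (ℕtoℚ a ℚ.- z) ℚ.* ℚ.- (+ 1 / suc k)) (ℕtoℚ-+-suc a k) ⟩
  (ℕtoℚ a ℚ.- (ℕtoℚ a ℚ.+ ℕtoℚ (suc k))) ℚ.* ℚ.- (+ 1 / suc k)
    ≡⟨ solve 3 (λ x y z → (x :- (x :+ y)) :* (:- z) := y :* z) refl (ℕtoℚ a) (ℕtoℚ (suc k)) (+ 1 / suc k) ⟩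
  ℕtoℚ (suc k) ℚ.* (+ 1 / suc k)
    ≡⟨ ℕtoℚ-suc-inverse k ⟩
  1ℚ ∎
  where open ≡-Reasoning
... | ℕ.equal .a = ⊥-elim (a≢j refl)
... | ℕ.greater .j k = begin
  (ℕtoℚ (suc (j ℕ.+ k)) ℚ.- ℕtoℚ j) ℚ.* (+ 1 / suc k)
    ≡⟨ cong (λ z → (z ℚ.- ℕtoℚ j) ℚ.* (+ 1 / suc k)) (ℕtoℚ-+-suc j k) ⟩
  (ℕtoℚ j ℚ.+ ℕtoℚ (suc k) ℚ.- ℕtoℚ j) ℚ.* (+ 1 / suc k)
    ≡⟨ solve 3 (λ x y z → (x :+ y :- x) :* z := y :* z) refl (ℕtoℚ j) (ℕtoℚ (suc k)) (+ 1 / suc k) ⟩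
  ℕtoℚ (suc k) ℚ.* (+ 1 / suc k)
    ≡⟨ ℕtoℚ-suc-inverse k ⟩
  1ℚ ∎
  where open ≡-Reasoning

-- Evaluation is a ring homomorphism

sumℚ : List ℚ → ℚ
sumℚ = foldr ℚ._+_ 0ℚ

productℚ : List ℚ → ℚ
productℚ = foldr ℚ._*_ 1ℚ

monomial : ∀ {n} → Vec ℕ n → Vec ℚ n → ℚ
monomial e x = Vec.foldr′ ℚ._*_ 1ℚ (zipWith powℚ x e)

evalT : ∀ {n} → Term n → Vec ℚ n → ℚ
evalT (c , e) x = c ℚ.* monomial e x

-- `(t ∷ p) *P q` unfolds to `map (t ·_) q ++ p *P q`.
infixl 7 _·_
_·_ : ∀ {n} → Term n → Term n → Term n
(c , e) · (d , e′) = (c ℚ.* d , zipWith ℕ._+_ e e′)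

powℚ-+ : ∀ x a b → powℚ x (a ℕ.+ b) ≡ powℚ x a ℚ.* powℚ x b
powℚ-+ x zero    b = sym (ℚP.*-identityˡ _)
powℚ-+ x (suc a) b rewrite powℚ-+ x a b = sym (ℚP.*-assoc x (powℚ x a) (powℚ x b))

monomial-+ : ∀ {n} (e e′ : Vec ℕ n) x → monomial (zipWith ℕ._+_ e e′) x ≡ monomial e x ℚ.* monomial e′ x
monomial-+ []      []       []       = refl
monomial-+ (a ∷ e) (b ∷ e′) (x ∷ xs) rewrite powℚ-+ x a b | monomial-+ e e′ xs =
  solve 4 (λ p q r s → (p :* q) :* (r :* s) := (p :* r) :* (q :* s)) refl
    (powℚ x a) (powℚ x b) (monomial e xs) (monomial e′ xs)

monomial-0 : ∀ {n} (x : Vec ℚ n) → monomial (replicate n 0) x ≡ 1ℚ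
monomial-0 []       = refl
monomial-0 (x ∷ xs) rewrite monomial-0 xs = refl

monomial-var : ∀ {n} (k : Fin n) x → monomial (replicate n 0 [ k ]≔ 1) x ≡ lookup x k
monomial-var fzero    (x ∷ xs) rewrite monomial-0 xs = trans (ℚP.*-identityʳ _) (ℚP.*-identityʳ x)
monomial-var (fsuc k) (x ∷ xs) rewrite monomial-var k xs = ℚP.*-identityˡ _

evalT-· : ∀ {n} (t s : Term n) x → evalT (t · s) x ≡ evalT t x ℚ.* evalT s x
evalT-· (c , e) (d , e′) x rewrite monomial-+ e e′ x =
  solve 4 (λ c d m m′ → (c :* d) :* (m :* m′) := (c :* m) :* (d :* m′)) refl
    c d (monomial e x) (monomial e′ x)

evalP-++ : ∀ {n} (p q : Poly n) x → evalP (p ++ q) x ≡ evalP p x ℚ.+ evalP q x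
evalP-++ []      q x = sym (ℚP.+-identityˡ _)
evalP-++ (t ∷ p) q x rewrite evalP-++ p q x = sym (ℚP.+-assoc (evalT t x) (evalP p x) (evalP q x))

evalP-neg : ∀ {n} (p : Poly n) x → evalP (-P p) x ≡ ℚ.- evalP p x
evalP-neg []            x = refl
evalP-neg ((c , e) ∷ p) x = trans (cong (ℚ.- c ℚ.* monomial e x ℚ.+_) (evalP-neg p x))
  (solve 3 (λ c m r → (:- c) :* m :+ (:- r) := :- (c :* m :+ r)) refl c (monomial e x) (evalP p x))

evalP-- : ∀ {n} (p q : Poly n) x → evalP (p -P q) x ≡ evalP p x ℚ.- evalP q x
evalP-- p q x rewrite evalP-++ p (-P q) x | evalP-neg q x = refl

evalP-map-· : ∀ {n} (t : Term n) q x → evalP (map (t ·_) q) x ≡ evalT t x ℚ.* evalP q x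
evalP-map-· t []      x = sym (ℚP.*-zeroʳ (evalT t x))
evalP-map-· t (s ∷ q) x rewrite evalT-· t s x | evalP-map-· t q x =
  sym (ℚP.*-distribˡ-+ (evalT t x) (evalT s x) (evalP q x))

evalP-* : ∀ {n} (p q : Poly n) x → evalP (p *P q) x ≡ evalP p x ℚ.* evalP q x
evalP-* []      q x = sym (ℚP.*-zeroˡ (evalP q x))
evalP-* (t ∷ p) q x = begin
  evalP (map (t ·_) q ++ p *P q) x                    ≡⟨ evalP-++ (map (t ·_) q) (p *P q) x ⟩
  evalP (map (t ·_) q) x ℚ.+ evalP (p *P q) x          ≡⟨ cong₂ ℚ._+_ (evalP-map-· t q x) (evalP-* p q x) ⟩
  evalT t x ℚ.* evalP q x ℚ.+ evalP p x ℚ.* evalP q x  ≡⟨ ℚP.*-distribʳ-+ (evalP q x) (evalT t x) (evalP p x) ⟨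
  (evalT t x ℚ.+ evalP p x) ℚ.* evalP q x              ∎
  where open ≡-Reasoning

evalP-const : ∀ {n} c (x : Vec ℚ n) → evalP (const c) x ≡ c
evalP-const c x rewrite monomial-0 x = trans (ℚP.+-identityʳ _) (ℚP.*-identityʳ c)

evalP-var : ∀ {n} (k : Fin n) x → evalP (var k) x ≡ lookup x k
evalP-var k x rewrite monomial-var k x = trans (ℚP.+-identityʳ _) (ℚP.*-identityˡ _)

evalP-prodP : ∀ {n} (ps : List (Poly n)) x → evalP (prodP ps) x ≡ productℚ (map (λ p → evalP p x) ps)
evalP-prodP []       x = evalP-const 1ℚ x
evalP-prodP (p ∷ ps) x rewrite evalP-* p (prodP ps) x | evalP-prodP ps x = refl

evalP-sumP : ∀ {n} (ps : List (Poly n)) x → evalP (sumP ps) x ≡ sumℚ (map (λ p → evalP p x) ps)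
evalP-sumP []       x = refl
evalP-sumP (p ∷ ps) x rewrite evalP-++ p (sumP ps) x | evalP-sumP ps x = refl

-- Coefficients

coeffT : ∀ {n} → Term n → Vec ℕ n → ℚ
coeffT (c , e′) e with ≡-dec ℕ._≟_ e′ e
... | yes _ = c
... | no  _ = 0ℚ

coeff-∷ : ∀ {n} (t : Term n) p e → coeff (t ∷ p) e ≡ coeffT t e ℚ.+ coeff p e
coeff-∷ (c , e′) p e with ≡-dec ℕ._≟_ e′ e
... | yes _ = refl
... | no  _ = sym (ℚP.+-identityˡ _)

coeffT-≢ : ∀ {n} c {e′ e : Vec ℕ n} → e′ ≢ e → coeffT (c , e′) e ≡ 0ℚ
coeffT-≢ c {e′} {e} e′≢e with ≡-dec ℕ._≟_ e′ e
... | yes e′≡e = ⊥-elim (e′≢e e′≡e)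
... | no  _    = refl

coeffT-0 : ∀ {n} (t : Term n) e → proj₁ t ≡ 0ℚ → coeffT t e ≡ 0ℚ
coeffT-0 (c , e′) e c≡0 with ≡-dec ℕ._≟_ e′ e
... | yes _ = c≡0
... | no  _ = refl

coeffT-neg : ∀ {n} c (e′ e : Vec ℕ n) → coeffT (ℚ.- c , e′) e ≡ ℚ.- coeffT (c , e′) e
coeffT-neg c e′ e with ≡-dec ℕ._≟_ e′ e
... | yes _ = refl
... | no  _ = refl

coeff-++ : ∀ {n} (p q : Poly n) e → coeff (p ++ q) e ≡ coeff p e ℚ.+ coeff q e
coeff-++ []      q e = sym (ℚP.+-identityˡ _)
coeff-++ (t ∷ p) q e = begin
  coeff (t ∷ p ++ q) e                       ≡⟨ coeff-∷ t (p ++ q) e ⟩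
  coeffT t e ℚ.+ coeff (p ++ q) e            ≡⟨ cong (coeffT t e ℚ.+_) (coeff-++ p q e) ⟩
  coeffT t e ℚ.+ (coeff p e ℚ.+ coeff q e)   ≡⟨ ℚP.+-assoc (coeffT t e) (coeff p e) (coeff q e) ⟨
  coeffT t e ℚ.+ coeff p e ℚ.+ coeff q e     ≡⟨ cong (ℚ._+ coeff q e) (coeff-∷ t p e) ⟨
  coeff (t ∷ p) e ℚ.+ coeff q e              ∎
  where open ≡-Reasoning

coeff-neg : ∀ {n} (p : Poly n) e → coeff (-P p) e ≡ ℚ.- coeff p e
coeff-neg []             e = refl
coeff-neg ((c , e′) ∷ p) e = begin
  coeff ((ℚ.- c , e′) ∷ -P p) e                        ≡⟨ coeff-∷ (ℚ.- c , e′) (-P p) e ⟩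
  coeffT (ℚ.- c , e′) e ℚ.+ coeff (-P p) e             ≡⟨ cong₂ ℚ._+_ (coeffT-neg c e′ e) (coeff-neg p e) ⟩
  ℚ.- coeffT (c , e′) e ℚ.+ ℚ.- coeff p e              ≡⟨ ℚP.neg-distrib-+ (coeffT (c , e′) e) (coeff p e) ⟨
  ℚ.- (coeffT (c , e′) e ℚ.+ coeff p e)                ≡⟨ cong ℚ.-_ (coeff-∷ (c , e′) p e) ⟨
  ℚ.- coeff ((c , e′) ∷ p) e                           ∎
  where open ≡-Reasoning

coeff-- : ∀ {n} (p q : Poly n) e → coeff (p -P q) e ≡ coeff p e ℚ.- coeff q e
coeff-- p q e = trans (coeff-++ p (-P q) e) (cong (coeff p e ℚ.+_) (coeff-neg q e))

removeMonomial : ∀ {n} → Vec ℕ n → Poly n → Poly n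
removeMonomial e = filter (λ t → ¬? (≡-dec ℕ._≟_ (proj₂ t) e))

evalP-removeMonomial : ∀ {n} (p : Poly n) e x →
  evalP p x ≡ coeff p e ℚ.* monomial e x ℚ.+ evalP (removeMonomial e p) x
evalP-removeMonomial []             e x = sym (trans (ℚP.+-identityʳ _) (ℚP.*-zeroˡ (monomial e x)))
evalP-removeMonomial ((c , e′) ∷ p) e x with ≡-dec ℕ._≟_ e′ e | evalP-removeMonomial p e x
... | yes refl | eq = trans (cong (c ℚ.* monomial e′ x ℚ.+_) eq)
  (solve 4 (λ c m k r → c :* m :+ (k :* m :+ r) := (c :+ k) :* m :+ r) refl
    c (monomial e′ x) (coeff p e′) (evalP (removeMonomial e′ p) x))
... | no _     | eq = trans (cong (c ℚ.* monomial e′ x ℚ.+_) eq)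
  (solve 5 (λ c m k M r → c :* m :+ (k :* M :+ r) := k :* M :+ (c :* m :+ r)) refl
    c (monomial e′ x) (coeff p e) (monomial e x) (evalP (removeMonomial e p) x))

coeff-removeMonomial-≡ : ∀ {n} (p : Poly n) e → coeff (removeMonomial e p) e ≡ 0ℚ
coeff-removeMonomial-≡ []             e = refl
coeff-removeMonomial-≡ ((c , e′) ∷ p) e with ≡-dec ℕ._≟_ e′ e
... | yes _    = coeff-removeMonomial-≡ p e
... | no e′≢e  = begin
  coeff ((c , e′) ∷ removeMonomial e p) e              ≡⟨ coeff-∷ (c , e′) (removeMonomial e p) e ⟩
  coeffT (c , e′) e ℚ.+ coeff (removeMonomial e p) e   ≡⟨ cong₂ ℚ._+_ (coeffT-≢ c e′≢e) (coeff-removeMonomial-≡ p e) ⟩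
  0ℚ                                                   ∎
  where open ≡-Reasoning

coeff-removeMonomial-≢ : ∀ {n} (p : Poly n) {e e″} → e″ ≢ e → coeff (removeMonomial e p) e″ ≡ coeff p e″
coeff-removeMonomial-≢ []             e″≢e = refl
coeff-removeMonomial-≢ ((c , e′) ∷ p) {e} {e″} e″≢e with ≡-dec ℕ._≟_ e′ e
... | yes refl = begin
  coeff (removeMonomial e′ p) e″              ≡⟨ coeff-removeMonomial-≢ p e″≢e ⟩
  coeff p e″                                  ≡⟨ ℚP.+-identityˡ (coeff p e″) ⟨
  0ℚ ℚ.+ coeff p e″                           ≡⟨ cong (ℚ._+ coeff p e″) (coeffT-≢ c (e″≢e ∘ sym)) ⟨
  coeffT (c , e′) e″ ℚ.+ coeff p e″           ≡⟨ coeff-∷ (c , e′) p e″ ⟨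
  coeff ((c , e′) ∷ p) e″                     ∎
  where open ≡-Reasoning
... | no _ = begin
  coeff ((c , e′) ∷ removeMonomial e p) e″              ≡⟨ coeff-∷ (c , e′) (removeMonomial e p) e″ ⟩
  coeffT (c , e′) e″ ℚ.+ coeff (removeMonomial e p) e″  ≡⟨ cong (coeffT (c , e′) e″ ℚ.+_) (coeff-removeMonomial-≢ p e″≢e) ⟩
  coeffT (c , e′) e″ ℚ.+ coeff p e″                     ≡⟨ coeff-∷ (c , e′) p e″ ⟨
  coeff ((c , e′) ∷ p) e″                               ∎
  where open ≡-Reasoning

removeMonomial-shorter : ∀ {n} c (e : Vec ℕ n) p → length (removeMonomial e ((c , e) ∷ p)) < length ((c , e) ∷ p)
removeMonomial-shorter c e p rewrite ListP.filter-reject (λ t → ¬? (≡-dec ℕ._≟_ (proj₂ t) e)) {x = c , e} {xs = p} (λ e≢e → e≢e refl) =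
  ℕ.s≤s (ListP.length-filter (λ t → ¬? (≡-dec ℕ._≟_ (proj₂ t) e)) p)

coeff≡0⇒evalP≡0 : ∀ {n} (p : Poly n) x → (∀ e → coeff p e ≡ 0ℚ) → evalP p x ≡ 0ℚ
coeff≡0⇒evalP≡0 p x = go p (<-wellFounded (length p))
  where
  -- Each step drops every term carrying the head's exponent, so the length decreases.
  go : ∀ p → Acc _<_ (length p) → (∀ e → coeff p e ≡ 0ℚ) → evalP p x ≡ 0ℚ
  go []             _         _   = refl
  go p@((c , e) ∷ p′) (acc rec) p≈0 = begin
    evalP p x                                                  ≡⟨ evalP-removeMonomial p e x ⟩
    coeff p e ℚ.* monomial e x ℚ.+ evalP (removeMonomial e p) x
      ≡⟨ cong₂ (λ a b → a ℚ.* monomial e x ℚ.+ b) (p≈0 e) (go (removeMonomial e p) (rec (removeMonomial-shorter c e p′)) rest≈0) ⟩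
    0ℚ ℚ.* monomial e x ℚ.+ 0ℚ                                 ≡⟨ cong (ℚ._+ 0ℚ) (ℚP.*-zeroˡ (monomial e x)) ⟩
    0ℚ                                                         ∎
    where
    open ≡-Reasoning
    rest≈0 : ∀ e′ → coeff (removeMonomial e p) e′ ≡ 0ℚ
    rest≈0 e′ with ≡-dec ℕ._≟_ e′ e
    ... | yes refl  = coeff-removeMonomial-≡ p e
    ... | no e′≢e   = trans (coeff-removeMonomial-≢ p e′≢e) (p≈0 e′)

≈⇒evalP≡ : ∀ {n} (p q : Poly n) → p ≈ q → ∀ x → evalP p x ≡ evalP q x
≈⇒evalP≡ p q p≈q x = Equivalence.to (difference≡0⇔≡ _ _) (begin
  evalP p x ℚ.- evalP q x  ≡⟨ evalP-- p q x ⟨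
  evalP (p -P q) x         ≡⟨ coeff≡0⇒evalP≡0 (p -P q) x (λ e →
                                trans (coeff-- p q e) (Equivalence.from (difference≡0⇔≡ _ _) (p≈q e))) ⟩
  0ℚ                       ∎)
  where open ≡-Reasoning

sumℚ-map-0 : ∀ {A : Set} (f : A → ℚ) xs → (∀ a → f a ≡ 0ℚ) → sumℚ (map f xs) ≡ 0ℚ
sumℚ-map-0 f []       f≡0 = refl
sumℚ-map-0 f (a ∷ xs) f≡0 rewrite f≡0 a | sumℚ-map-0 f xs f≡0 = refl

sumℚ-map-+ : ∀ {A : Set} (f g : A → ℚ) xs →
  sumℚ (map (λ a → f a ℚ.+ g a) xs) ≡ sumℚ (map f xs) ℚ.+ sumℚ (map g xs)
sumℚ-map-+ f g []       = refl
sumℚ-map-+ f g (a ∷ xs) rewrite sumℚ-map-+ f g xs =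
  solve 4 (λ a b c d → (a :+ b) :+ (c :+ d) := (a :+ c) :+ (b :+ d)) refl
    (f a) (g a) (sumℚ (map f xs)) (sumℚ (map g xs))

sumℚ-map-swap : ∀ {A B : Set} (F : A → B → ℚ) xs ys →
  sumℚ (map (λ a → sumℚ (map (F a) ys)) xs) ≡ sumℚ (map (λ b → sumℚ (map (λ a → F a b) xs)) ys)
sumℚ-map-swap F []       ys = sym (sumℚ-map-0 _ ys (λ _ → refl))
sumℚ-map-swap F (a ∷ xs) ys rewrite sumℚ-map-swap F xs ys =
  sym (sumℚ-map-+ (F a) (λ b → sumℚ (map (λ a → F a b) xs)) ys)

coeff-map-· : ∀ {n} (t : Term n) q e → coeff (map (t ·_) q) e ≡ sumℚ (map (λ s → coeffT (t · s) e) q)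
coeff-map-· t []      e = refl
coeff-map-· t (s ∷ q) e = trans (coeff-∷ (t · s) (map (t ·_) q) e) (cong (coeffT (t · s) e ℚ.+_) (coeff-map-· t q e))

coeff-* : ∀ {n} (p q : Poly n) e →
  coeff (p *P q) e ≡ sumℚ (map (λ t → sumℚ (map (λ s → coeffT (t · s) e) q)) p)
coeff-* []      q e = refl
coeff-* (t ∷ p) q e = trans (coeff-++ (map (t ·_) q) (p *P q) e)
                            (cong₂ ℚ._+_ (coeff-map-· t q e) (coeff-* p q e))

coeffT-·-comm : ∀ {n} (t s : Term n) e → coeffT (t · s) e ≡ coeffT (s · t) e
coeffT-·-comm (c , e₁) (d , e₂) e =
  cong₂ (λ e′ a → coeffT (a , e′) e) (VecP.zipWith-comm ℕP.+-comm e₁ e₂) (ℚP.*-comm c d)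

*P-comm : ∀ {n} (p q : Poly n) → p *P q ≈ q *P p
*P-comm p q e = begin
  coeff (p *P q) e                                                  ≡⟨ coeff-* p q e ⟩
  sumℚ (map (λ t → sumℚ (map (λ s → coeffT (t · s) e) q)) p)        ≡⟨ sumℚ-map-swap (λ t s → coeffT (t · s) e) p q ⟩
  sumℚ (map (λ s → sumℚ (map (λ t → coeffT (t · s) e) p)) q)
    ≡⟨ cong sumℚ (ListP.map-cong (λ s → cong sumℚ (ListP.map-cong (λ t → coeffT-·-comm t s e) p)) q) ⟩
  sumℚ (map (λ s → sumℚ (map (λ t → coeffT (s · t) e) p)) q)        ≡⟨ coeff-* q p e ⟨
  coeff (q *P p) e                                                  ∎
  where open ≡-Reasoning

const0-*P≈0P : ∀ {n} {c} (q : Poly n) → c ≡ 0ℚ → const c *P q ≈ 0P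
const0-*P≈0P {c = c} q c≡0 e = trans (coeff-* (const c) q e)
  (trans (ℚP.+-identityʳ _) (sumℚ-map-0 _ q (λ s → coeffT-0 ((c , replicate _ 0) · s) e (trans (cong (ℚ._* proj₁ s) c≡0) (ℚP.*-zeroˡ (proj₁ s))))))

∣P⇒evalP≢0 : ∀ {n} (A B : Poly n) x → A ∣P B → evalP B x ≢ 0ℚ → evalP A x ≢ 0ℚ
∣P⇒evalP≢0 A B x (r , Ar≈B) B≢0 A≡0 = B≢0 (begin
  evalP B x                 ≡⟨ ≈⇒evalP≡ (A *P r) B Ar≈B x ⟨
  evalP (A *P r) x          ≡⟨ evalP-* A r x ⟩
  evalP A x ℚ.* evalP r x   ≡⟨ cong (ℚ._* evalP r x) A≡0 ⟩
  0ℚ ℚ.* evalP r x          ≡⟨ ℚP.*-zeroˡ (evalP r x) ⟩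
  0ℚ                        ∎)
  where open ≡-Reasoning

IsLCM⇒evalP≢0⇔ : ∀ {n} (P Q L : Poly n) → IsLCM P Q L →
  ∀ x → (evalP L x ≢ 0ℚ) ⇔ (evalP P x ≢ 0ℚ × evalP Q x ≢ 0ℚ)
IsLCM⇒evalP≢0⇔ P Q L (P∣L , Q∣L , least) x = mk⇔
  (λ L≢0 → ∣P⇒evalP≢0 P L x P∣L L≢0 , ∣P⇒evalP≢0 Q L x Q∣L L≢0)
  (λ (P≢0 , Q≢0) → ∣P⇒evalP≢0 L (P *P Q) x (least (P *P Q) (Q , λ _ → refl) (P , *P-comm Q P))
                     (λ PQ≡0 → p*q≢0 P≢0 Q≢0 (trans (sym (evalP-* P Q x)) PQ≡0)))

-- Lagrange interpolation on the grid

productℚ-map-1 : ∀ {A : Set} (f : A → ℚ) xs → (∀ {a} → a ∈ xs → f a ≡ 1ℚ) → productℚ (map f xs) ≡ 1ℚ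
productℚ-map-1 f []       f≡1 = refl
productℚ-map-1 f (a ∷ xs) f≡1 rewrite f≡1 (here refl) | productℚ-map-1 f xs (f≡1 ∘ there) = refl

productℚ-map-0 : ∀ {A : Set} (f : A → ℚ) {xs a} → a ∈ xs → f a ≡ 0ℚ → productℚ (map f xs) ≡ 0ℚ
productℚ-map-0 f {_ ∷ xs} (here refl) fa≡0 rewrite fa≡0 = ℚP.*-zeroˡ (productℚ (map f xs))
productℚ-map-0 f {b ∷ _}  (there a∈xs) fa≡0 rewrite productℚ-map-0 f a∈xs fa≡0 = ℚP.*-zeroʳ (f b)

sumℚ-++ : ∀ xs ys → sumℚ (xs ++ ys) ≡ sumℚ xs ℚ.+ sumℚ ys
sumℚ-++ []       ys = sym (ℚP.+-identityˡ _)
sumℚ-++ (x ∷ xs) ys rewrite sumℚ-++ xs ys = sym (ℚP.+-assoc x (sumℚ xs) (sumℚ ys))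

sumℚ-map-concatMap : ∀ {A B : Set} (h : B → ℚ) (f : A → List B) xs →
  sumℚ (map h (concatMap f xs)) ≡ sumℚ (map (λ a → sumℚ (map h (f a))) xs)
sumℚ-map-concatMap h f []       = refl
sumℚ-map-concatMap h f (a ∷ xs) = begin
  sumℚ (map h (f a ++ concatMap f xs))                  ≡⟨ cong sumℚ (ListP.map-++ h (f a) (concatMap f xs)) ⟩
  sumℚ (map h (f a) ++ map h (concatMap f xs))          ≡⟨ sumℚ-++ (map h (f a)) (map h (concatMap f xs)) ⟩
  sumℚ (map h (f a)) ℚ.+ sumℚ (map h (concatMap f xs))  ≡⟨ cong (sumℚ (map h (f a)) ℚ.+_) (sumℚ-map-concatMap h f xs) ⟩
  sumℚ (map h (f a)) ℚ.+ sumℚ (map (λ a → sumℚ (map h (f a))) xs) ∎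
  where open ≡-Reasoning

sumℚ-tabulate-single : ∀ {n} (u : Fin n → ℚ) b → (∀ a → a ≢ b → u a ≡ 0ℚ) → sumℚ (tabulate u) ≡ u b
sumℚ-tabulate-single {suc n} u fzero u≡0 = begin
  u fzero ℚ.+ sumℚ (tabulate (u ∘ fsuc))  ≡⟨ cong (λ s → u fzero ℚ.+ sumℚ s) (ListP.map-tabulate id (u ∘ fsuc)) ⟨
  u fzero ℚ.+ sumℚ (map (u ∘ fsuc) (allFin n))
    ≡⟨ cong (u fzero ℚ.+_) (sumℚ-map-0 (u ∘ fsuc) (allFin n) (λ a → u≡0 (fsuc a) λ ())) ⟩
  u fzero ℚ.+ 0ℚ                          ≡⟨ ℚP.+-identityʳ (u fzero) ⟩
  u fzero                                 ∎
  where open ≡-Reasoning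
sumℚ-tabulate-single {suc n} u (fsuc b) u≡0 = begin
  u fzero ℚ.+ sumℚ (tabulate (u ∘ fsuc))  ≡⟨ cong (ℚ._+ sumℚ (tabulate (u ∘ fsuc))) (u≡0 fzero λ ()) ⟩
  0ℚ ℚ.+ sumℚ (tabulate (u ∘ fsuc))       ≡⟨ ℚP.+-identityˡ _ ⟩
  sumℚ (tabulate (u ∘ fsuc))              ≡⟨ sumℚ-tabulate-single (u ∘ fsuc) b (λ a a≢b → u≡0 (fsuc a) (a≢b ∘ FinP.suc-injective)) ⟩
  u (fsuc b)                              ∎
  where open ≡-Reasoning

sumℚ-allVecs-single : ∀ {n} m (y : Vec (Fin n) m) (h : Vec (Fin n) m → ℚ) →
  (∀ g → g ≢ y → h g ≡ 0ℚ) → sumℚ (map h (allVecs m)) ≡ h y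
sumℚ-allVecs-single zero    []       h h≡0 = ℚP.+-identityʳ (h [])
sumℚ-allVecs-single {n} (suc m) (b ∷ y) h h≡0 = begin
  sumℚ (map h (concatMap (λ a → map (a ∷_) (allVecs m)) (allFin n)))
    ≡⟨ sumℚ-map-concatMap h (λ a → map (a ∷_) (allVecs m)) (allFin n) ⟩
  sumℚ (map (λ a → sumℚ (map h (map (a ∷_) (allVecs m)))) (allFin n))
    ≡⟨ cong sumℚ (ListP.map-tabulate id (λ a → sumℚ (map h (map (a ∷_) (allVecs m))))) ⟩
  sumℚ (tabulate (λ a → sumℚ (map h (map (a ∷_) (allVecs m)))))
    ≡⟨ sumℚ-tabulate-single _ b (λ a a≢b → trans (cong sumℚ (sym (ListP.map-∘ (allVecs m))))
         (sumℚ-map-0 (λ g → h (a ∷ g)) (allVecs m) (λ g → h≡0 (a ∷ g) (a≢b ∘ VecP.∷-injectiveˡ)))) ⟩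
  sumℚ (map h (map (b ∷_) (allVecs m)))
    ≡⟨ cong sumℚ (ListP.map-∘ (allVecs m)) ⟨
  sumℚ (map (λ g → h (b ∷ g)) (allVecs m))
    ≡⟨ sumℚ-allVecs-single m y (λ g → h (b ∷ g)) (λ g g≢y → h≡0 (b ∷ g) (g≢y ∘ VecP.∷-injectiveʳ)) ⟩
  h (b ∷ y) ∎
  where open ≡-Reasoning

gridPoint : ∀ {n m} → Vec (Fin n) m → Vec ℚ m
gridPoint = Vec.map (λ a → ℕtoℚ (toℕ a))

evalP-var-gridPoint : ∀ {n} (k : Fin n) (y : Vec (Fin n) n) → evalP (var k) (gridPoint y) ≡ ℕtoℚ (toℕ (lookup y k))
evalP-var-gridPoint k y = trans (evalP-var k (gridPoint y)) (VecP.lookup-map k _ y)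

module _ {n} (k a : Fin n) (y : Vec (Fin n) n) where
  private
    others : List (Fin n)
    others = filter (λ j → ¬? (a FinP.≟ j)) (allFin n)

    factor : Fin n → ℚ
    factor j = (ℕtoℚ (toℕ (lookup y k)) ℚ.- ℕtoℚ (toℕ j)) ℚ.* invDiff (toℕ a) (toℕ j)

    factorP : Fin n → Poly n
    factorP j = (var k -P const (ℕtoℚ (toℕ j))) *P const (invDiff (toℕ a) (toℕ j))

    evalP-factorP : ∀ j → evalP (factorP j) (gridPoint y) ≡ factor j
    evalP-factorP j = trans (evalP-* (var k -P const (ℕtoℚ (toℕ j))) (const (invDiff (toℕ a) (toℕ j))) (gridPoint y))
      (cong₂ ℚ._*_ (trans (evalP-- (var k) (const (ℕtoℚ (toℕ j))) (gridPoint y))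
                          (cong₂ ℚ._-_ (evalP-var-gridPoint k y) (evalP-const (ℕtoℚ (toℕ j)) (gridPoint y))))
                   (evalP-const (invDiff (toℕ a) (toℕ j)) (gridPoint y)))

    evalP-lagrangeFactor : evalP (lagrangeFactor k a) (gridPoint y) ≡ productℚ (map factor others)
    evalP-lagrangeFactor = begin
      evalP (prodP (map factorP others)) (gridPoint y)                  ≡⟨ evalP-prodP (map factorP others) (gridPoint y) ⟩
      productℚ (map (λ p → evalP p (gridPoint y)) (map factorP others)) ≡⟨ cong productℚ (ListP.map-∘ others) ⟨
      productℚ (map (λ j → evalP (factorP j) (gridPoint y)) others)     ≡⟨ cong productℚ (ListP.map-cong evalP-factorP others) ⟩
      productℚ (map factor others)                                      ∎
      where open ≡-Reasoning

  evalP-lagrangeFactor-≡ : a ≡ lookup y k → evalP (lagrangeFactor k a) (gridPoint y) ≡ 1ℚ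
  evalP-lagrangeFactor-≡ refl = trans evalP-lagrangeFactor (productℚ-map-1 factor others (λ {j} j∈ →
    invDiff-inverse (toℕ a) (toℕ j) (proj₂ (∈-filter⁻ (λ j → ¬? (a FinP.≟ j)) {xs = allFin n} j∈) ∘ FinP.toℕ-injective)))

  evalP-lagrangeFactor-≢ : a ≢ lookup y k → evalP (lagrangeFactor k a) (gridPoint y) ≡ 0ℚ
  evalP-lagrangeFactor-≢ a≢yₖ = trans evalP-lagrangeFactor (productℚ-map-0 factor
    (∈-filter⁺ (λ j → ¬? (a FinP.≟ j)) (∈-allFin (lookup y k)) a≢yₖ)
    (trans (cong (ℚ._* invDiff (toℕ a) (toℕ (lookup y k))) (ℚP.+-inverseʳ (ℕtoℚ (toℕ (lookup y k)))))
           (ℚP.*-zeroˡ (invDiff (toℕ a) (toℕ (lookup y k))))))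

lagrangeBasis : ∀ {n} → Vec (Fin n) n → Poly n
lagrangeBasis {n} g = prodP (map (λ k → lagrangeFactor k (lookup g k)) (allFin n))

evalP-lagrangeBasis : ∀ {n} (g y : Vec (Fin n) n) →
  evalP (lagrangeBasis g) (gridPoint y) ≡ productℚ (map (λ k → evalP (lagrangeFactor k (lookup g k)) (gridPoint y)) (allFin n))
evalP-lagrangeBasis {n} g y = trans (evalP-prodP (map (λ k → lagrangeFactor k (lookup g k)) (allFin n)) (gridPoint y)) (cong productℚ (sym (ListP.map-∘ (allFin n))))

evalP-lagrangeBasis-≡ : ∀ {n} (y : Vec (Fin n) n) → evalP (lagrangeBasis y) (gridPoint y) ≡ 1ℚ
evalP-lagrangeBasis-≡ {n} y = trans (evalP-lagrangeBasis y y)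
  (productℚ-map-1 _ (allFin n) (λ {k} _ → evalP-lagrangeFactor-≡ k (lookup y k) y refl))

evalP-lagrangeBasis-≢ : ∀ {n} (g y : Vec (Fin n) n) → g ≢ y → evalP (lagrangeBasis g) (gridPoint y) ≡ 0ℚ
evalP-lagrangeBasis-≢ {n} g y g≢y with FinP.all? (λ k → lookup g k FinP.≟ lookup y k)
... | yes gₖ≡yₖ = ⊥-elim (g≢y (Pointwise-≡⇒≡ (ext gₖ≡yₖ)))
... | no  g≉y  with FinP.¬∀⟶∃¬ n _ (λ k → lookup g k FinP.≟ lookup y k) g≉y
...   | k , gₖ≢yₖ = trans (evalP-lagrangeBasis g y)
  (productℚ-map-0 _ (∈-allFin k) (evalP-lagrangeFactor-≢ k (lookup g k) y gₖ≢yₖ))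

evalP-reduce : ∀ {n} (L : Poly n) (y : Vec (Fin n) n) → evalP (reduce L) (gridPoint y) ≡ evalP L (gridPoint y)
evalP-reduce {n} L y = begin
  evalP (reduce L) (gridPoint y)
    ≡⟨ evalP-sumP (map interpolant (allVecs n)) (gridPoint y) ⟩
  sumℚ (map (λ p → evalP p (gridPoint y)) (map interpolant (allVecs n)))
    ≡⟨ cong sumℚ (ListP.map-∘ (allVecs n)) ⟨
  sumℚ (map (λ g → evalP (interpolant g) (gridPoint y)) (allVecs n))
    ≡⟨ sumℚ-allVecs-single n y _ (λ g g≢y → trans (evalP-interpolant g)
         (trans (cong (evalP L (gridPoint g) ℚ.*_) (evalP-lagrangeBasis-≢ g y g≢y)) (ℚP.*-zeroʳ (evalP L (gridPoint g))))) ⟩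
  evalP (interpolant y) (gridPoint y)
    ≡⟨ evalP-interpolant y ⟩
  evalP L (gridPoint y) ℚ.* evalP (lagrangeBasis y) (gridPoint y)
    ≡⟨ cong (evalP L (gridPoint y) ℚ.*_) (evalP-lagrangeBasis-≡ y) ⟩
  evalP L (gridPoint y) ℚ.* 1ℚ
    ≡⟨ ℚP.*-identityʳ _ ⟩
  evalP L (gridPoint y) ∎
  where
  open ≡-Reasoning
  interpolant : Vec (Fin n) n → Poly n
  interpolant g = const (evalP L (gridPoint g)) *P lagrangeBasis g
  evalP-interpolant : ∀ g → evalP (interpolant g) (gridPoint y) ≡ evalP L (gridPoint g) ℚ.* evalP (lagrangeBasis g) (gridPoint y)
  evalP-interpolant g = trans (evalP-* (const (evalP L (gridPoint g))) (lagrangeBasis g) (gridPoint y))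
    (cong (ℚ._* evalP (lagrangeBasis g) (gridPoint y)) (evalP-const (evalP L (gridPoint g)) (gridPoint y)))

sumP≈0P : ∀ {n} {ps : List (Poly n)} → All (_≈ 0P) ps → sumP ps ≈ 0P
sumP≈0P []               e = refl
sumP≈0P {ps = p ∷ ps} (p≈0 ∷ ps≈0) e = trans (coeff-++ p (sumP ps) e) (cong₂ ℚ._+_ (p≈0 e) (sumP≈0P ps≈0 e))

reduce≈0P : ∀ {n} (L : Poly n) → All (λ g → evalP L (gridPoint g) ≡ 0ℚ) (allVecs n) → reduce L ≈ 0P
reduce≈0P L L≡0 = sumP≈0P (AllP.map⁺ (All.map (λ {g} → const0-*P≈0P (lagrangeBasis g)) L≡0))

reduce≉0P⇔nonvanishing : ∀ {n} (L : Poly n) → (¬ reduce L ≈ 0P) ⇔ (∃[ y ] evalP L (gridPoint y) ≢ 0ℚ)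
reduce≉0P⇔nonvanishing {n} L = mk⇔ nonvanishing (λ (y , L≢0) reduceL≈0 →
  L≢0 (trans (sym (evalP-reduce L y)) (≈⇒evalP≡ (reduce L) 0P reduceL≈0 (gridPoint y))))
  where
  nonvanishing : ¬ reduce L ≈ 0P → ∃[ y ] evalP L (gridPoint y) ≢ 0ℚ
  nonvanishing reduceL≉0 with all? (λ g → evalP L (gridPoint g) ℚP.≟ 0ℚ) (allVecs n)
  ... | yes vanishing = ⊥-elim (reduceL≉0 (reduce≈0P L vanishing))
  ... | no ¬vanishing = satisfied (¬All⇒Any¬ (λ g → evalP L (gridPoint g) ℚP.≟ 0ℚ) (allVecs n) ¬vanishing)

-- Products over the pairs i < j

productℚ-map-≢0 : ∀ {A : Set} (f : A → ℚ) xs → (∀ {a} → a ∈ xs → f a ≢ 0ℚ) → productℚ (map f xs) ≢ 0ℚ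
productℚ-map-≢0 f []       f≢0 ()
productℚ-map-≢0 f (a ∷ xs) f≢0 = p*q≢0 (f≢0 (here refl)) (productℚ-map-≢0 f xs (f≢0 ∘ there))

module _ {n} (F : Fin n → Fin n → Poly n) where

  private
    column : Fin n → List (Poly n)
    column j = map (λ i → F i j) (filter (λ i → toℕ i ℕP.<? toℕ j) (allFin n))

  pairFactors : List (Poly n)
  pairFactors = concatMap column (allFin n)

  ∈-pairFactors⁺ : ∀ {i j} → toℕ i < toℕ j → F i j ∈ pairFactors
  ∈-pairFactors⁺ {i} {j} i<j = ∈-concat⁺′
    (∈-map⁺ (λ i → F i j) (∈-filter⁺ (λ i → toℕ i ℕP.<? toℕ j) (∈-allFin i) i<j))
    (∈-map⁺ column (∈-allFin j))

  ∈-pairFactors⁻ : ∀ {p} → p ∈ pairFactors → ∃[ i ] ∃[ j ] toℕ i < toℕ j × p ≡ F i j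
  ∈-pairFactors⁻ p∈ with ∈-concat⁻′ (map column (allFin n)) p∈
  ... | _ , p∈column , column∈ with ∈-map⁻ column column∈
  ... | j , _ , refl with ∈-map⁻ (λ i → F i j) p∈column
  ... | i , i∈ , refl = i , j , proj₂ (∈-filter⁻ (λ i → toℕ i ℕP.<? toℕ j) {xs = allFin n} i∈) , refl

  evalP-prodPairs-≢0⇔ : ∀ x → (evalP (prodPairs F) x ≢ 0ℚ) ⇔ (∀ i j → toℕ i < toℕ j → evalP (F i j) x ≢ 0ℚ)
  evalP-prodPairs-≢0⇔ x = mk⇔
    (λ prod≢0 i j i<j Fij≡0 → prod≢0 (trans evalP-prodPairs (productℚ-map-0 _ (∈-pairFactors⁺ i<j) Fij≡0)))
    (λ F≢0 prod≡0 → productℚ-map-≢0 _ pairFactors (λ p∈ → factor≢0 F≢0 (∈-pairFactors⁻ p∈)) (trans (sym evalP-prodPairs) prod≡0))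
    where
    evalP-prodPairs : evalP (prodPairs F) x ≡ productℚ (map (λ p → evalP p x) pairFactors)
    evalP-prodPairs = evalP-prodP pairFactors x
    factor≢0 : (∀ i j → toℕ i < toℕ j → evalP (F i j) x ≢ 0ℚ) → ∀ {p} → ∃[ i ] ∃[ j ] toℕ i < toℕ j × p ≡ F i j → evalP p x ≢ 0ℚ
    factor≢0 F≢0 (i , j , i<j , refl) = F≢0 i j i<j

  evalP-prodPairs-≢0⇔injective : ∀ {A : Set} x (h : Fin n → A) → (∀ i j → (evalP (F i j) x ≡ 0ℚ) ⇔ (h j ≡ h i)) →
    (evalP (prodPairs F) x ≢ 0ℚ) ⇔ Injective _≡_ _≡_ h
  evalP-prodPairs-≢0⇔injective x h F≡0⇔ = mk⇔ nonvanishing⇒injective injective⇒nonvanishing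
    where
    nonvanishing⇒injective : evalP (prodPairs F) x ≢ 0ℚ → Injective _≡_ _≡_ h
    nonvanishing⇒injective prod≢0 {i} {j} hi≡hj with ℕP.<-cmp (toℕ i) (toℕ j)
    ... | tri< i<j _ _ = ⊥-elim (Equivalence.to (evalP-prodPairs-≢0⇔ x) prod≢0 i j i<j (Equivalence.from (F≡0⇔ i j) (sym hi≡hj)))
    ... | tri≈ _ i≡j _ = FinP.toℕ-injective i≡j
    ... | tri> _ _ j<i = ⊥-elim (Equivalence.to (evalP-prodPairs-≢0⇔ x) prod≢0 j i j<i (Equivalence.from (F≡0⇔ j i) hi≡hj))

    injective⇒nonvanishing : Injective _≡_ _≡_ h → evalP (prodPairs F) x ≢ 0ℚ
    injective⇒nonvanishing h-inj = Equivalence.from (evalP-prodPairs-≢0⇔ x) λ i j i<j Fij≡0 →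
      ℕP.<-irrefl (cong toℕ (sym (h-inj (Equivalence.to (F≡0⇔ i j) Fij≡0)))) i<j

edgeLength : ∀ {n} → (Fin n → Fin n) → Vec (Fin n) n → Fin n → ℕ
edgeLength f y k = ∣ toℕ (lookup y (f k)) - toℕ (lookup y k) ∣

evalP-var-difference : ∀ {n} (a b : Fin n) (y : Vec (Fin n) n) →
  evalP (var a -P var b) (gridPoint y) ≡ ℕtoℚ (toℕ (lookup y a)) ℚ.- ℕtoℚ (toℕ (lookup y b))
evalP-var-difference a b y =
  trans (evalP-- (var a) (var b) (gridPoint y)) (cong₂ ℚ._-_ (evalP-var-gridPoint a y) (evalP-var-gridPoint b y))

evalP-vandermondeFactor≡0⇔ : ∀ {n} (y : Vec (Fin n) n) i j →
  (evalP (var j -P var i) (gridPoint y) ≡ 0ℚ) ⇔ (lookup y j ≡ lookup y i)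
evalP-vandermondeFactor≡0⇔ y i j = mk⇔
  (λ factor≡0 → FinP.toℕ-injective (Equivalence.to (ℕtoℚ-difference≡0⇔≡ yⱼ yᵢ) (trans (sym (evalP-var-difference j i y)) factor≡0)))
  (λ yⱼ≡yᵢ → trans (evalP-var-difference j i y) (Equivalence.from (ℕtoℚ-difference≡0⇔≡ yⱼ yᵢ) (cong toℕ yⱼ≡yᵢ)))
  where
  yⱼ = toℕ (lookup y j)
  yᵢ = toℕ (lookup y i)

evalP-square-var-difference : ∀ {n} (a b : Fin n) (y : Vec (Fin n) n) →
  evalP (sq (var a -P var b)) (gridPoint y) ≡ ℕtoℚ (∣ toℕ (lookup y a) - toℕ (lookup y b) ∣ ℕ.* ∣ toℕ (lookup y a) - toℕ (lookup y b) ∣)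
evalP-square-var-difference a b y = begin
  evalP (sq (var a -P var b)) (gridPoint y)
    ≡⟨ evalP-* (var a -P var b) (var a -P var b) (gridPoint y) ⟩
  evalP (var a -P var b) (gridPoint y) ℚ.* evalP (var a -P var b) (gridPoint y)
    ≡⟨ cong₂ ℚ._*_ (evalP-var-difference a b y) (evalP-var-difference a b y) ⟩
  (ℕtoℚ (toℕ (lookup y a)) ℚ.- ℕtoℚ (toℕ (lookup y b))) ℚ.* (ℕtoℚ (toℕ (lookup y a)) ℚ.- ℕtoℚ (toℕ (lookup y b)))
    ≡⟨ ℕtoℚ-difference² (toℕ (lookup y a)) (toℕ (lookup y b)) ⟩
  ℕtoℚ (∣ toℕ (lookup y a) - toℕ (lookup y b) ∣ ℕ.* ∣ toℕ (lookup y a) - toℕ (lookup y b) ∣) ∎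
  where open ≡-Reasoning

evalP-graceFactor≡0⇔ : ∀ {n} (f : Fin n → Fin n) (y : Vec (Fin n) n) i j →
  (evalP (sq (var (f j) -P var j) -P sq (var (f i) -P var i)) (gridPoint y) ≡ 0ℚ) ⇔ (edgeLength f y j ≡ edgeLength f y i)
evalP-graceFactor≡0⇔ f y i j = mk⇔
  (λ factor≡0 → square-injective (Equivalence.to (ℕtoℚ-difference≡0⇔≡ (dⱼ ℕ.* dⱼ) (dᵢ ℕ.* dᵢ)) (trans (sym factor≡diff) factor≡0)))
  (λ dⱼ≡dᵢ → trans factor≡diff (Equivalence.from (ℕtoℚ-difference≡0⇔≡ (dⱼ ℕ.* dⱼ) (dᵢ ℕ.* dᵢ)) (cong₂ ℕ._*_ dⱼ≡dᵢ dⱼ≡dᵢ)))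
  where
  dⱼ = edgeLength f y j
  dᵢ = edgeLength f y i
  factor≡diff : evalP (sq (var (f j) -P var j) -P sq (var (f i) -P var i)) (gridPoint y) ≡ ℕtoℚ (dⱼ ℕ.* dⱼ) ℚ.- ℕtoℚ (dᵢ ℕ.* dᵢ)
  factor≡diff = trans (evalP-- (sq (var (f j) -P var j)) (sq (var (f i) -P var i)) (gridPoint y))
    (cong₂ ℚ._-_ (evalP-square-var-difference (f j) j y) (evalP-square-var-difference (f i) i y))

evalP-vandermonde-≢0⇔ : ∀ {n} (y : Vec (Fin n) n) →
  (evalP (vandermonde n) (gridPoint y) ≢ 0ℚ) ⇔ Injective _≡_ _≡_ (lookup y)
evalP-vandermonde-≢0⇔ y = evalP-prodPairs-≢0⇔injective (λ i j → var j -P var i) (gridPoint y) (lookup y) (evalP-vandermondeFactor≡0⇔ y)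

evalP-gracePoly-≢0⇔ : ∀ {n} (f : Fin n → Fin n) (y : Vec (Fin n) n) →
  (evalP (gracePoly f) (gridPoint y) ≢ 0ℚ) ⇔ Injective _≡_ _≡_ (edgeLength f y)
evalP-gracePoly-≢0⇔ f y = evalP-prodPairs-≢0⇔injective (λ i j → sq (var (f j) -P var j) -P sq (var (f i) -P var i)) (gridPoint y) (edgeLength f y) (evalP-graceFactor≡0⇔ f y)

-- Graceful labellings

injective⇒surjective : ∀ {n} (h : Fin n → Fin n) → Injective _≡_ _≡_ h → ∀ b → ∃ λ a → h a ≡ b
injective⇒surjective {suc m} h h-inj b with FinP.any? (λ a → h a FinP.≟ b)
... | yes hit  = hit
... | no  miss = ⊥-elim (ℕP.1+n≰n (FinP.injective⇒≤ punchOut∘h-injective))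
  where
  b≢h : ∀ a → b ≢ h a
  b≢h a b≡ha = miss (a , sym b≡ha)
  punchOut∘h-injective : Injective _≡_ _≡_ (λ a → punchOut (b≢h a))
  punchOut∘h-injective eq = h-inj (FinP.punchOut-injective (b≢h _) (b≢h _) eq)

surjective⇒injective : ∀ {n} (h : Fin n → Fin n) → (∀ b → ∃ λ a → h a ≡ b) → Injective _≡_ _≡_ h
surjective⇒injective h h-surj {i} {j} hi≡hj = begin
  i        ≡⟨ g∘h≗id i ⟨
  g (h i)  ≡⟨ cong g hi≡hj ⟩
  g (h j)  ≡⟨ g∘h≗id j ⟩
  j        ∎
  where
  open ≡-Reasoning
  g : _ → _
  g b = proj₁ (h-surj b)
  h∘g≗id : ∀ b → h (g b) ≡ b
  h∘g≗id b = proj₂ (h-surj b)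
  g-injective : Injective _≡_ _≡_ g
  g-injective {a} {b} ga≡gb = trans (sym (h∘g≗id a)) (trans (cong h ga≡gb) (h∘g≗id b))
  g∘h≗id : ∀ i → g (h i) ≡ i
  g∘h≗id i with injective⇒surjective g g-injective i
  ... | a , refl = cong g (h∘g≗id a)

module _ {n} (h : Fin n → ℕ) (h<n : ∀ i → h i < n) where
  private
    hFin : Fin n → Fin n
    hFin i = fromℕ< (h<n i)

    toℕ-hFin : ∀ i → toℕ (hFin i) ≡ h i
    toℕ-hFin i = FinP.toℕ-fromℕ< (h<n i)

  injective⇒covers : Injective _≡_ _≡_ h → ∀ m → m < n → ∃ λ i → h i ≡ m
  injective⇒covers h-inj m m<n with injective⇒surjective hFin hFin-injective (fromℕ< m<n)
    where
    hFin-injective : Injective _≡_ _≡_ hFin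
    hFin-injective eq = h-inj (trans (sym (toℕ-hFin _)) (trans (cong toℕ eq) (toℕ-hFin _)))
  ... | i , hFinᵢ≡m = i , trans (sym (toℕ-hFin i)) (trans (cong toℕ hFinᵢ≡m) (FinP.toℕ-fromℕ< m<n))

  covers⇒injective : (∀ m → m < n → ∃ λ i → h i ≡ m) → Injective _≡_ _≡_ h
  covers⇒injective h-covers hi≡hj =
    surjective⇒injective hFin hFin-surjective (FinP.toℕ-injective (trans (toℕ-hFin _) (trans hi≡hj (sym (toℕ-hFin _)))))
    where
    hFin-surjective : ∀ b → ∃ λ a → hFin a ≡ b
    hFin-surjective b with h-covers (toℕ b) (FinP.toℕ<n b)
    ... | a , hₐ≡b = a , FinP.toℕ-injective (trans (toℕ-hFin a) hₐ≡b)

∣toℕ-toℕ∣<n : ∀ {n} (a b : Fin n) → ∣ toℕ a - toℕ b ∣ < n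
∣toℕ-toℕ∣<n a b = ℕP.≤-<-trans (ℕP.∣m-n∣≤m⊔n (toℕ a) (toℕ b)) (ℕP.⊔-lub (FinP.toℕ<n a) (FinP.toℕ<n b))

GracefulLabelling : ∀ {n} → (Fin n → Fin n) → Vec (Fin n) n → Set
GracefulLabelling f y = Injective _≡_ _≡_ (lookup y) × Injective _≡_ _≡_ (edgeLength f y)

module _ {n} (f : Fin n → Fin n) where

  graceful⇒labelling : Graceful f → ∃[ y ] GracefulLabelling f y
  graceful⇒labelling (σ , lengths) = y , y-injective , edgeLength-injective
    where
    y : Vec (Fin n) n
    y = Vec.tabulate (σ ⟨$⟩ʳ_)
    lookup-y : ∀ k → lookup y k ≡ σ ⟨$⟩ʳ k
    lookup-y = VecP.lookup∘tabulate (σ ⟨$⟩ʳ_)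
    σ-injective : Injective _≡_ _≡_ (σ ⟨$⟩ʳ_)
    σ-injective eq = trans (sym (inverseˡ σ)) (trans (cong (σ ⟨$⟩ˡ_) eq) (inverseˡ σ))
    y-injective : Injective _≡_ _≡_ (lookup y)
    y-injective eq = σ-injective (trans (sym (lookup-y _)) (trans eq (lookup-y _)))
    conjugateLength : Fin n → ℕ
    conjugateLength i = ∣ toℕ (σ ⟨$⟩ʳ f (σ ⟨$⟩ˡ i)) - toℕ i ∣
    conjugateLength-injective : Injective _≡_ _≡_ conjugateLength
    conjugateLength-injective = covers⇒injective conjugateLength (λ i → Equivalence.to (lengths _) (i , refl)) (λ m → Equivalence.from (lengths m))
    edgeLength≡conjugateLength : ∀ k → edgeLength f y k ≡ conjugateLength (σ ⟨$⟩ʳ k)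
    edgeLength≡conjugateLength k rewrite lookup-y k | lookup-y (f k) | inverseˡ σ {k} = refl
    edgeLength-injective : Injective _≡_ _≡_ (edgeLength f y)
    edgeLength-injective eq = σ-injective (conjugateLength-injective (trans (sym (edgeLength≡conjugateLength _)) (trans eq (edgeLength≡conjugateLength _))))

  labelling⇒graceful : ∃[ y ] GracefulLabelling f y → Graceful f
  labelling⇒graceful (y , y-injective , edgeLength-injective) = σ , λ m → mk⇔ (length<n m) (covered m)
    where
    y-surjective : ∀ b → ∃ λ a → lookup y a ≡ b
    y-surjective = injective⇒surjective (lookup y) y-injective
    σ : Permutation′ n
    σ = permutation (lookup y) (proj₁ ∘ y-surjective) (proj₂ ∘ y-surjective) (λ a → y-injective (proj₂ (y-surjective (lookup y a))))
    length<n : ∀ m → (∃[ i ] ∣ toℕ (σ ⟨$⟩ʳ f (σ ⟨$⟩ˡ i)) - toℕ i ∣ ≡ m) → m < n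
    length<n m (i , refl) = ∣toℕ-toℕ∣<n (σ ⟨$⟩ʳ f (σ ⟨$⟩ˡ i)) i
    covered : ∀ m → m < n → ∃[ i ] ∣ toℕ (σ ⟨$⟩ʳ f (σ ⟨$⟩ˡ i)) - toℕ i ∣ ≡ m
    covered m m<n with injective⇒covers (edgeLength f y) (λ k → ∣toℕ-toℕ∣<n (lookup y (f k)) (lookup y k)) edgeLength-injective m m<n
    ... | k , refl = lookup y k , cong (λ i → ∣ toℕ (lookup y (f i)) - toℕ (lookup y k) ∣) (inverseˡ σ)

  graceful⇔labelling : Graceful f ⇔ (∃[ y ] GracefulLabelling f y)
  graceful⇔labelling = mk⇔ graceful⇒labelling labelling⇒graceful

proposition11 : (n : ℕ) (f : Fin n → Fin n) (L : Poly n) →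
    IsLCM (vandermonde n) (gracePoly f) L →
    (Graceful f ⇔ (¬ (reduce L ≈ 0P)))
proposition11 n f L lcm = begin
  Graceful f
    ∼⟨ graceful⇔labelling f ⟩
  (∃[ y ] GracefulLabelling f y)
    ∼⟨ Σ.congˡ (⇔-sym (evalP-vandermonde-≢0⇔ _ ×-⇔ evalP-gracePoly-≢0⇔ f _)) ⟩
  (∃[ y ] evalP (vandermonde n) (gridPoint y) ≢ 0ℚ × evalP (gracePoly f) (gridPoint y) ≢ 0ℚ)
    ∼⟨ Σ.congˡ (⇔-sym (IsLCM⇒evalP≢0⇔ (vandermonde n) (gracePoly f) L lcm _)) ⟩
  (∃[ y ] evalP L (gridPoint y) ≢ 0ℚ)
    ∼⟨ ⇔-sym (reduce≉0P⇔nonvanishing L) ⟩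
  (¬ reduce L ≈ 0P) ∎
  where open Related.EquationalReasoning
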